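{- Let $p$ be a pattern in which no two consecutive letters are equal. Let $X$ and $Y$ be words of nonnegative integers, $a\ge 0$ an integer and $r\ge 1$, and let $x=X\,a^r\,Y$ (with $a^r$ denoting $r$ consecutive copies of $a$) and $x'=X\,a\,Y$, where $x$ and $x'$ are ascent sequences avoiding $p$. Then for every integer $b\ge 0$, the word $xb$ is an ascent sequence avoiding $p$ if and only if $x'b$ is an ascent sequence avoiding $p$.
   Context: An ascent of an integer word $x_1\cdots x_n$ is an index $j$ with $x_j<x_{j+1}$; $\mathrm{asc}(x_1\cdots x_n)$ denotes the number of ascents. An ascent sequence of length $n$ is a sequence $x_1\cdots x_n$ of nonnegative integers with $x_1=0$ and $x_i\le \mathrm{asc}(x_1\cdots x_{i-1})+1$ for all $1<i\le n$. A pattern is a word $p=p_1\cdots p_k$ of nonnegative integers whose set of values is $\{0,1,\dots,m\}$ for some $m$. A word $x_1\cdots x_n$ contains $p$ if there are indices $i_1<\cdots<i_k$ such that $x_{i_1}\cdots x_{i_k}$ is order-isomorphic to $p$ (i.e. for all $s,t$, $x_{i_s}<x_{i_t}$ iff $p_s<p_t$ and $x_{i_s}=x_{i_t}$ iff $p_s=p_t$); otherwise it avoids $p$. For a word $w$ and integer $b$, $wb$ denotes the word obtained by appending $b$. -}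

module Defs where

open import Data.Nat using (ℕ; zero; suc; _+_; _<_; _≤_)
open import Data.Bool using (true; false; if_then_else_)
open import Data.List using (List; []; _∷_; _++_; length; replicate; lookup; take; [_])
open import Data.List.Relation.Binary.Sublist.Propositional using (_⊆_)
open import Data.List.Membership.Propositional using (_∈_)
open import Data.Fin using (Fin; toℕ)
open import Data.Product using (Σ; ∃; _×_; _,_)
open import Data.Sum using (_⊎_)
open import Relation.Binary.PropositionalEquality using (_≡_)
open import Relation.Nullary using (¬_)

Word : Set
Word = List ℕ

ascFrom : ℕ → Word → ℕ
ascFrom x [] = 0
ascFrom x (y ∷ w) = (if x Data.Nat.<ᵇ y then 1 else 0) + ascFrom y w

asc : Word → ℕ
asc [] = 0
asc (x ∷ w) = ascFrom x w

-- Ascent sequence: x_1 = 0 and x_i ≤ asc(x_1 ⋯ x_{i-1}) + 1 for 1 < i ≤ n.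
-- (Using 0-based positions i; the prefix x_1⋯x_{i-1} is  take i w.)
IsAscentSeq : Word → Set
IsAscentSeq [] = Data.Unit.⊤
  where import Data.Unit
IsAscentSeq (x ∷ w) =
  x ≡ 0 × (∀ (i : Fin (length (x ∷ w))) → 0 < toℕ i →
           lookup (x ∷ w) i ≤ asc (take (toℕ i) (x ∷ w)) + 1)

IsPattern : Word → Set
IsPattern p = ∃ λ m → ∀ v → (v ∈ p → v ≤ m) × (v ≤ m → v ∈ p)

OrderIso : Word → Word → Set
OrderIso u p = Σ (length u ≡ length p) λ eq →
  ∀ (s t : Fin (length u)) →
    ((lookup u s < lookup u t) ⇔ (lookup p (cast eq s) < lookup p (cast eq t)))
  × ((lookup u s ≡ lookup u t) ⇔ (lookup p (cast eq s) ≡ lookup p (cast eq t)))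
  where
    open import Function.Bundles using (_⇔_)
    open import Data.Fin using (cast)

Contains : Word → Word → Set
Contains w p = ∃ λ u → u ⊆ w × OrderIso u p

Avoids : Word → Word → Set
Avoids w p = ¬ Contains w p

NoConsecutiveEqual : Word → Set
NoConsecutiveEqual p = ∀ (xs ys : Word) (c : ℕ) → ¬ (p ≡ xs ++ c ∷ c ∷ ys)

AscAvoid : Word → Word → Set
AscAvoid w p = IsAscentSeq w × Avoids w p

-- Repeating a letter creates no ascent, so x and x′ have the same number of
-- ascents, and appending b keeps both of them ascent sequences or neither. An
-- occurrence of p in x′b is also one in xb since x′ is a subword of x. Conversely
-- an occurrence of p in xb uses at most one copy of the block aʳ: two copies
-- would be adjacent equal letters of the occurrence, hence of p. So it is also
-- an occurrence in x′b.
module Submission where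

open import Defs
open import Data.Nat using (ℕ; zero; suc; _+_; _<_; _≤_; _<ᵇ_; s≤s; z≤n)
open import Data.Nat.Properties using (suc-injective)
open import Data.Bool using (false)
open import Data.List using ([]; _∷_; _++_; replicate; [_]; length; lookup; take)
open import Data.List.Properties using (++-assoc; ++-conicalʳ)
open import Data.List.Relation.Binary.Sublist.Propositional using (_⊆_; _∷_; _∷ʳ_; ⊆-refl; ⊆-trans)
open import Data.List.Relation.Binary.Sublist.Propositional.Properties
  using (++⁺; ++⁺ˡ)
open import Data.Fin using (Fin; toℕ) renaming (zero to fzero; suc to fsuc)
open import Data.Product using (Σ; _×_; _,_; proj₂)
open import Data.Product.Function.NonDependent.Propositional using (_×-⇔_)
open import Data.Sum using (_⊎_; inj₁; inj₂)
open import Function.Bundles using (_⇔_; mk⇔; Equivalence)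
open import Function.Properties.Equivalence using () renaming (trans to ⇔-trans; sym to ⇔-sym)
open import Relation.Binary.PropositionalEquality
  using (_≡_; _≢_; refl; sym; trans; cong; subst; subst₂)
open import Relation.Nullary using (contradiction)

n<ᵇn≡false : ∀ n → (n <ᵇ n) ≡ false
n<ᵇn≡false zero    = refl
n<ᵇn≡false (suc n) = n<ᵇn≡false n

ascFrom-destutter : ∀ a Z c (X : Word) → ascFrom c (X ++ a ∷ a ∷ Z) ≡ ascFrom c (X ++ a ∷ Z)
ascFrom-destutter a Z c []      rewrite n<ᵇn≡false a = refl
ascFrom-destutter a Z c (x ∷ X) = cong (_ +_) (ascFrom-destutter a Z x X)

asc-destutter : ∀ (X : Word) a Z → asc (X ++ a ∷ a ∷ Z) ≡ asc (X ++ a ∷ Z)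
asc-destutter []      a Z rewrite n<ᵇn≡false a = refl
asc-destutter (x ∷ X) a Z = ascFrom-destutter a Z x X

asc-replicate : ∀ (X : Word) a k Z → asc (X ++ replicate (suc k) a ++ Z) ≡ asc (X ++ a ∷ Z)
asc-replicate X a zero    Z = refl
asc-replicate X a (suc k) Z = trans (asc-destutter X a (replicate k a ++ Z)) (asc-replicate X a k Z)

snoc-last : ∀ (w : Word) b →
  Σ (Fin (length (w ++ [ b ]))) λ i → lookup (w ++ [ b ]) i ≡ b × take (toℕ i) (w ++ [ b ]) ≡ w
snoc-last []      b = fzero , refl , refl
snoc-last (x ∷ w) b with snoc-last w b
... | i , lookup≡b , take≡w = fsuc i , lookup≡b , cong (x ∷_) take≡w

snoc-index-view : ∀ (w : Word) b (i : Fin (length (w ++ [ b ]))) →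
  (Σ (Fin (length w)) λ j → toℕ j ≡ toℕ i × lookup (w ++ [ b ]) i ≡ lookup w j
                             × take (toℕ i) (w ++ [ b ]) ≡ take (toℕ j) w)
  ⊎ (lookup (w ++ [ b ]) i ≡ b × take (toℕ i) (w ++ [ b ]) ≡ w)
snoc-index-view []      b fzero    = inj₂ (refl , refl)
snoc-index-view (x ∷ w) b fzero    = inj₁ (fzero , refl , refl , refl)
snoc-index-view (x ∷ w) b (fsuc i) with snoc-index-view w b i
... | inj₁ (j , j≡i , lookup≡ , take≡) = inj₁ (fsuc j , cong suc j≡i , lookup≡ , cong (x ∷_) take≡)
... | inj₂ (lookup≡b , take≡w)         = inj₂ (lookup≡b , cong (x ∷_) take≡w)

isAscentSeq-snoc : ∀ {w : Word} b → w ≢ [] → IsAscentSeq w →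
                   IsAscentSeq (w ++ [ b ]) ⇔ b ≤ asc w + 1
isAscentSeq-snoc {[]}    b w≢[] _ = contradiction refl w≢[]
isAscentSeq-snoc {c ∷ v} b _ (c≡0 , bounded) = mk⇔ last-bounded extend
  where
  last-bounded : IsAscentSeq (c ∷ v ++ [ b ]) → b ≤ asc (c ∷ v) + 1
  last-bounded (_ , bounded′) with snoc-last v b
  ... | i , lookup≡b , take≡v =
    subst₂ (λ y u → y ≤ asc u + 1) lookup≡b (cong (c ∷_) take≡v) (bounded′ (fsuc i) (s≤s z≤n))

  extend : b ≤ asc (c ∷ v) + 1 → IsAscentSeq (c ∷ v ++ [ b ])
  extend b≤ = c≡0 , bounded′
    where
    bounded′ : ∀ (i : Fin (length (c ∷ v ++ [ b ]))) → 0 < toℕ i →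
               lookup (c ∷ v ++ [ b ]) i ≤ asc (take (toℕ i) (c ∷ v ++ [ b ])) + 1
    bounded′ i 0<i with snoc-index-view (c ∷ v) b i
    ... | inj₁ (j , j≡i , lookup≡ , take≡) =
      subst₂ (λ y u → y ≤ asc u + 1) (sym lookup≡) (sym take≡) (bounded j (subst (0 <_) (sym j≡i) 0<i))
    ... | inj₂ (lookup≡b , take≡w) =
      subst₂ (λ y u → y ≤ asc u + 1) (sym lookup≡b) (sym take≡w) b≤

noConsecutiveEqual-tail : ∀ {x} {u : Word} → NoConsecutiveEqual (x ∷ u) → NoConsecutiveEqual u
noConsecutiveEqual-tail nce xs ys c u≡ = nce (_ ∷ xs) ys c (cong (_ ∷_) u≡)

orderIso-tail : ∀ {x y} {u q : Word} → OrderIso (x ∷ u) (y ∷ q) → OrderIso u q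
orderIso-tail (len≡ , iso) = suc-injective len≡ , λ s t → iso (fsuc s) (fsuc t)

orderIso-noConsecutiveEqual : ∀ {u q : Word} → OrderIso u q → NoConsecutiveEqual q → NoConsecutiveEqual u
orderIso-noConsecutiveEqual {q = []}         (() , _) _ []       _ _ refl
orderIso-noConsecutiveEqual {q = _ ∷ []}     (() , _) _ []       _ _ refl
orderIso-noConsecutiveEqual {q = d ∷ e ∷ q}  (_ , iso) nce []     _ _ refl =
  nce [] q d (cong (λ z → d ∷ z ∷ q) (sym (Equivalence.to (proj₂ (iso fzero (fsuc fzero))) refl)))
orderIso-noConsecutiveEqual {q = []}         (() , _) _ (_ ∷ _)  _ _ refl
orderIso-noConsecutiveEqual {q = _ ∷ _}      iso nce (_ ∷ u₁) u₃ c refl =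
  orderIso-noConsecutiveEqual (orderIso-tail iso) (noConsecutiveEqual-tail nce) u₁ u₃ c refl

⊆-destutter : ∀ (X : Word) {a Z u} → NoConsecutiveEqual u → u ⊆ X ++ a ∷ a ∷ Z → u ⊆ X ++ a ∷ Z
⊆-destutter [] _   (_ ∷ʳ σ)           = σ
⊆-destutter [] _   (a≡ ∷ (_ ∷ʳ σ))    = a≡ ∷ σ
⊆-destutter [] nce (refl ∷ (refl ∷ σ)) = contradiction refl (nce [] _ _)
⊆-destutter (x ∷ X) nce (_ ∷ʳ σ) = x ∷ʳ ⊆-destutter X nce σ
⊆-destutter (x ∷ X) nce (x≡ ∷ σ) = x≡ ∷ ⊆-destutter X (noConsecutiveEqual-tail nce) σ

Contains-⊆ : ∀ {v w p : Word} → v ⊆ w → Contains v p → Contains w p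
Contains-⊆ v⊆w (u , u⊆v , iso) = u , ⊆-trans u⊆v v⊆w , iso

Contains-destutter : ∀ {p} → NoConsecutiveEqual p → ∀ (X : Word) a Z →
                     Contains (X ++ a ∷ a ∷ Z) p → Contains (X ++ a ∷ Z) p
Contains-destutter nce X a Z (u , σ , iso) =
  u , ⊆-destutter X (orderIso-noConsecutiveEqual iso nce) σ , iso

Contains-replicate⁻ : ∀ {p} → NoConsecutiveEqual p → ∀ (X : Word) a k Z →
                      Contains (X ++ replicate (suc k) a ++ Z) p → Contains (X ++ a ∷ Z) p
Contains-replicate⁻ nce X a zero    Z c = c
Contains-replicate⁻ nce X a (suc k) Z c =
  Contains-replicate⁻ nce X a k Z (Contains-destutter nce X a (replicate k a ++ Z) c)

Avoids-replicate : ∀ {p} → NoConsecutiveEqual p → ∀ (X : Word) a k Z →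
                   Avoids (X ++ replicate (suc k) a ++ Z) p ⇔ Avoids (X ++ a ∷ Z) p
Avoids-replicate {p} nce X a k Z = mk⇔
  (λ avoid c → avoid (Contains-⊆ {p = p} (++⁺ ⊆-refl (refl ∷ ++⁺ˡ (replicate k a) ⊆-refl)) c))
  (λ avoid c → avoid (Contains-replicate⁻ nce X a k Z c))

++-∷-nonEmpty : ∀ (X : Word) a Z → X ++ a ∷ Z ≢ []
++-∷-nonEmpty X a Z eq with ++-conicalʳ X (a ∷ Z) eq
... | ()

lemma4p1 : (p : Word) → IsPattern p → NoConsecutiveEqual p →
           (X Y : Word) (a r : ℕ) → 1 ≤ r →
           AscAvoid (X ++ replicate r a ++ Y) p →
           AscAvoid (X ++ a ∷ Y) p →
           (b : ℕ) →
           (AscAvoid ((X ++ replicate r a ++ Y) ++ [ b ]) p ⇔ AscAvoid ((X ++ a ∷ Y) ++ [ b ]) p)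
lemma4p1 p _ nce X Y a (suc k) _ (x-asc , _) (x′-asc , _) b = ascent ×-⇔ avoidance
  where
  x x′ : Word
  x  = X ++ replicate (suc k) a ++ Y
  x′ = X ++ a ∷ Y

  ascent : IsAscentSeq (x ++ [ b ]) ⇔ IsAscentSeq (x′ ++ [ b ])
  ascent = ⇔-trans
    (subst (λ n → IsAscentSeq (x ++ [ b ]) ⇔ b ≤ n + 1) (asc-replicate X a k Y)
           (isAscentSeq-snoc b (++-∷-nonEmpty X a _) x-asc))
    (⇔-sym (isAscentSeq-snoc b (++-∷-nonEmpty X a Y) x′-asc))

  avoidance : Avoids (x ++ [ b ]) p ⇔ Avoids (x′ ++ [ b ]) p
  avoidance = subst₂ (λ u u′ → Avoids u p ⇔ Avoids u′ p)
    (sym (trans (++-assoc X _ [ b ]) (cong (X ++_) (++-assoc (replicate (suc k) a) Y [ b ]))))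
    (sym (++-assoc X (a ∷ Y) [ b ]))
    (Avoids-replicate nce X a k (Y ++ [ b ]))
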